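{- Let $S$ be a partial Sudoku of type $(h,w)$. Then $S$ has a completion (a Sudoku of type $(h,w)$ agreeing with $S$ on all filled cells) if and only if the graph $G_S$ has an edge-decomposition into tiles, and this holds if and only if the multigraph $G^*_S$ has a $K_4$-decomposition.
   Context: Let $h,w\ge 2$ be integers, $n=hw$, and rows, columns, symbols indexed by $[n]$. For a cell $(i,j)$ put $\mathrm{box}(i,j)=h\lfloor (i-1)/h\rfloor+\lfloor (j-1)/w\rfloor+1$; the boxes are the sets $\mathrm{box}^{ -1}(\ell)$, $\ell\in[n]$. A Sudoku of type $(h,w)$ is an $n\times n$ latin square on $[n]$ in which each symbol appears exactly once in each box; a partial Sudoku of type $(h,w)$ is an $n\times n$ array with cells empty or filled from $[n]$ such that each symbol appears at most once in each row, column and box. Row $i$ is incident with box $\ell$ if some cell $(i,j)$ has $\mathrm{box}(i,j)=\ell$; similarly for columns. The graph $G_{hw}$ has vertex set $\{r_1,\dots,r_n\}\cup\{c_1,\dots,c_n\}\cup\{b_1,\dots,b_n\}\cup\{s_1,\dots,s_n\}$ (rows, columns, boxes, symbols) and edge set consisting of all $\{r_i,c_j\},\{r_i,s_k\},\{c_j,s_k\},\{b_\ell,s_k\}$ for $i,j,k,\ell\in[n]$. A tile is the subgraph induced by four vertices $r_i,c_j,b_\ell,s_k$ with $\ell=\mathrm{box}(i,j)$, i.e. having edges $r_ic_j,r_is_k,c_js_k,b_\ell s_k$. For a partial Sudoku $S$, $G_S$ is obtained from $G_{hw}$ by deleting the edges of the tile $\{r_i,c_j,b_{\mathrm{box}(i,j)},s_k\}$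 for every filled cell $(i,j)$ containing symbol $k$; an edge-decomposition into tiles is a partition of $E(G_S)$ into edge sets of tiles. The multigraph $G^*_{hw}$ has the same vertices and all edges of $G_{hw}$, plus the edge $\{r_i,b_\ell\}$ with multiplicity $w$ whenever row $i$ is incident with box $\ell$, and the edge $\{c_j,b_\ell\}$ with multiplicity $h$ whenever column $j$ is incident with box $\ell$. $G^*_S$ is obtained from $G^*_{hw}$ by removing, for every filled cell $(i,j)$ of $S$ with symbol $k$, the edges of one $4$-clique on $\{r_i,c_j,b_{\mathrm{box}(i,j)},s_k\}$. A $K_4$-decomposition of a multigraph is a partition of its edge multiset (repeated edges distinguished) into copies of $K_4$. -}

module Defs where

open import Data.Nat using (ℕ; zero; suc; _+_; _*_; _∸_; _≤_; _<_; NonZero; >-nonZero; s≤s; z≤n)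
open import Data.Nat.Properties using (≤-trans; +-monoʳ-<; *-suc; *-monoʳ-≤; *-comm; ≤-reflexive; module ≤-Reasoning)
open import Data.Nat.DivMod using (_/_; m<n*o⇒m/o<n)
open import Data.Fin using (Fin; toℕ; fromℕ<) renaming (_≟_ to _≟F_)
open import Data.Fin.Properties using (toℕ<n; any?)
open import Data.Bool using (Bool; true; false; if_then_else_; _∧_; _∨_)
open import Data.Maybe using (Maybe; just; nothing)
open import Data.List using (List; []; _∷_; map)
open import Data.Nat.ListAction using (sum)
open import Data.Vec using (Vec; lookup; toList)
open import Data.Product using (Σ; _×_; _,_; ∃)
open import Data.Product.Properties using (≡-dec)
open import Relation.Nullary using (¬_; Dec; yes; no; does)
open import Relation.Binary.PropositionalEquality using (_≡_; _≢_; refl)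
open import Relation.Binary.Definitions using (DecidableEquality)
import Data.Nat.Properties
import Relation.Binary.PropositionalEquality
import Data.List.Membership.Propositional

-- Kinds of vertices of G_hw : rows, columns, boxes, symbols.
data Kind : Set where
  R C B Sy : Kind

_≟K_ : DecidableEquality Kind
R ≟K R = yes refl
R ≟K C = no λ ()
R ≟K B = no λ ()
R ≟K Sy = no λ ()
C ≟K R = no λ ()
C ≟K C = yes refl
C ≟K B = no λ ()
C ≟K Sy = no λ ()
B ≟K R = no λ ()
B ≟K C = no λ ()
B ≟K B = yes refl
B ≟K Sy = no λ ()
Sy ≟K R = no λ ()
Sy ≟K C = no λ ()
Sy ≟K B = no λ ()
Sy ≟K Sy = yes refl

-- Everything is indexed from 0 (Fin n) instead of [n] = {1,…,n}.
module Sudoku (h w : ℕ) (2≤h : 2 ≤ h) (2≤w : 2 ≤ w) where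

  private
    instance
      h≢0 : NonZero h
      h≢0 = >-nonZero (≤-trans (s≤s z≤n) 2≤h)
      w≢0 : NonZero w
      w≢0 = >-nonZero (≤-trans (s≤s z≤n) 2≤w)

  n : ℕ
  n = h * w

  -- 0-indexed version of box(i,j) = h⌊(i-1)/h⌋ + ⌊(j-1)/w⌋ + 1
  boxℕ : ℕ → ℕ → ℕ
  boxℕ i j = h * (i / h) + j / w

  boxℕ<n : (i j : Fin n) → boxℕ (toℕ i) (toℕ j) < n
  boxℕ<n i j = begin-strict
      h * a + b   <⟨ +-monoʳ-< (h * a) b<h ⟩
      h * a + h   ≡⟨ Data.Nat.Properties.+-comm (h * a) h ⟩
      h + h * a   ≡⟨ Relation.Binary.PropositionalEquality.sym (*-suc h a) ⟩
      h * suc a   ≤⟨ *-monoʳ-≤ h a<w ⟩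
      h * w       ∎
    where
    open ≤-Reasoning
    a = toℕ i / h
    b = toℕ j / w
    a<w : a < w
    a<w = m<n*o⇒m/o<n {n = w} (≤-trans (toℕ<n i) (≤-reflexive (*-comm h w)))
    b<h : b < h
    b<h = m<n*o⇒m/o<n {n = h} (toℕ<n j)

  box : Fin n → Fin n → Fin n
  box i j = fromℕ< (boxℕ<n i j)

  Array : Set
  Array = Fin n → Fin n → Maybe (Fin n)

  IsPartialSudoku : Array → Set
  IsPartialSudoku S =
      (∀ i j j' k → S i j ≡ just k → S i j' ≡ just k → j ≡ j')
    × (∀ i i' j k → S i j ≡ just k → S i' j ≡ just k → i ≡ i')
    × (∀ i j i' j' k → S i j ≡ just k → S i' j' ≡ just k → box i j ≡ box i' j' → (i , j) ≡ (i' , j'))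

  IsSudoku : (Fin n → Fin n → Fin n) → Set
  IsSudoku L =
      (∀ i k → Σ (Fin n) λ j → L i j ≡ k × (∀ j' → L i j' ≡ k → j' ≡ j))
    × (∀ j k → Σ (Fin n) λ i → L i j ≡ k × (∀ i' → L i' j ≡ k → i' ≡ i))
    × (∀ ℓ k → Σ (Fin n × Fin n) λ { (i , j) → box i j ≡ ℓ × L i j ≡ k
                × (∀ i' j' → box i' j' ≡ ℓ → L i' j' ≡ k → (i' , j') ≡ (i , j)) })

  HasCompletion : Array → Set
  HasCompletion S = Σ (Fin n → Fin n → Fin n) λ L →
    IsSudoku L × (∀ i j k → S i j ≡ just k → L i j ≡ k)

  V : Set
  V = Kind × Fin n

  _≟V_ : DecidableEquality V
  _≟V_ = ≡-dec _≟K_ _≟F_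

  _∈?_ : V → List V → Bool
  u ∈? [] = false
  u ∈? (x ∷ xs) = does (u ≟V x) ∨ (u ∈? xs)

  sumFin : ∀ {m} → (Fin m → ℕ) → ℕ
  sumFin {zero} f = 0
  sumFin {suc m} f = f Fin.zero + sumFin (λ x → f (Fin.suc x))

  -- number of edges {u,v} in G_hw (0 or 1)
  adj : V → V → ℕ
  adj (R , _) (C , _) = 1
  adj (C , _) (R , _) = 1
  adj (R , _) (Sy , _) = 1
  adj (Sy , _) (R , _) = 1
  adj (C , _) (Sy , _) = 1
  adj (Sy , _) (C , _) = 1
  adj (B , _) (Sy , _) = 1
  adj (Sy , _) (B , _) = 1
  adj _ _ = 0

  rowInc : Fin n → Fin n → Bool
  rowInc i ℓ = does (any? (λ j → box i j ≟F ℓ))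

  colInc : Fin n → Fin n → Bool
  colInc j ℓ = does (any? (λ i → box i j ≟F ℓ))

  -- edge multiplicities of the multigraph G*_hw
  adj* : V → V → ℕ
  adj* (R , i) (B , ℓ) = if rowInc i ℓ then w else 0
  adj* (B , ℓ) (R , i) = if rowInc i ℓ then w else 0
  adj* (C , j) (B , ℓ) = if colInc j ℓ then h else 0
  adj* (B , ℓ) (C , j) = if colInc j ℓ then h else 0
  adj* u v = adj u v

  cellVerts : Fin n → Fin n → Fin n → List V
  cellVerts i j k = (R , i) ∷ (C , j) ∷ (B , box i j) ∷ (Sy , k) ∷ []

  -- number of edges {u,v} in the tile on r_i, c_j, b_box(i,j), s_k
  -- (induced subgraph of G_hw, so 0 or 1)
  tileEdge : Fin n × Fin n × Fin n → V → V → ℕ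
  tileEdge (i , j , k) u v =
    if (u ∈? cellVerts i j k) ∧ (v ∈? cellVerts i j k) then adj u v else 0

  -- number of edges {u,v} in a 4-clique on the vertices of cellVerts (0 or 1, u ≢ v)
  cliqueEdge : Fin n × Fin n × Fin n → V → V → ℕ
  cliqueEdge (i , j , k) u v =
    if (u ∈? cellVerts i j k) ∧ (v ∈? cellVerts i j k) then 1 else 0

  filledSum : Array → (Fin n × Fin n × Fin n → V → V → ℕ) → V → V → ℕ
  filledSum S e u v = sumFin λ i → sumFin λ j → f (S i j) i j
    where
    f : Maybe (Fin n) → Fin n → Fin n → ℕ
    f nothing i j = 0
    f (just k) i j = e (i , j , k) u v

  G_S : Array → V → V → ℕ
  G_S S u v = adj u v ∸ filledSum S tileEdge u v

  G*_S : Array → V → V → ℕ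
  G*_S S u v = adj* u v ∸ filledSum S cliqueEdge u v

  -- edge-decomposition of G_S into tiles: a list of tiles (given by
  -- (i,j,k), the tile being on r_i, c_j, b_box(i,j), s_k) such that every
  -- edge of G_S lies in exactly one tile and no other edge is used
  TileDecomposition : Array → Set
  TileDecomposition S = Σ (List (Fin n × Fin n × Fin n)) λ T →
    ∀ u v → u ≢ v → sum (map (λ t → tileEdge t u v) T) ≡ G_S S u v

  -- a copy of K4: four distinct vertices
  Quad : Set
  Quad = Vec V 4

  Distinct : Quad → Set
  Distinct q = ∀ x y → x ≢ y → lookup q x ≢ lookup q y

  quadEdge : Quad → V → V → ℕ
  quadEdge q u v = if (u ∈? toList q) ∧ (v ∈? toList q) then 1 else 0

  K4Decomposition : (V → V → ℕ) → Set
  K4Decomposition G = Σ (List Quad) λ Q →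
    (∀ q → q Data.List.Membership.Propositional.∈ Q → Distinct q)
    × (∀ u v → u ≢ v → sum (map (λ q → quadEdge q u v) Q) ≡ G u v)

{-# OPTIONS --safe #-}
module Submission where

-- A grid L of symbols is a Sudoku exactly when its n² tiles cover every edge of G_hw once: the
-- r–s, c–s and b–s edges say that each symbol occurs once in each row, column and box, and the
-- r–c edges that each cell carries one symbol.  Hence the tiles of the empty cells of a completion
-- decompose G_S.  Conversely, in a tile decomposition of G_S the r–c edges put exactly one tile on
-- each empty cell and none on a filled one; reading off their symbols completes S, and since the
-- filled cells of a partial Sudoku use no edge twice, the resulting grid covers every edge once.
-- The 4-cliques of a Sudoku moreover cover each r–b edge w times and each c–b edge h times, which
-- is G*_hw.  Conversely the four vertices of a K4 in a decomposition of G*_S are pairwise adjacent,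
-- hence of four different kinds, and the r–b and c–b edges force the box vertex to be the box of
-- the row and column: every such K4 is the clique of a tile, and tiles cover G_S as cliques cover G*_S.

open import Defs
open import Data.Nat using (ℕ; _≤_; suc; _+_; _*_; _∸_; _<_; NonZero; >-nonZero; s≤s; z≤n)
open import Data.Product using (_×_; Σ; ∃; _,_; proj₁; proj₂)
open import Function.Bundles using (_⇔_; Equivalence; mk⇔)

open import Algebra.Properties.CommutativeSemigroup using (interchange)
open import Data.Bool using (true; false; if_then_else_; _∧_; _∨_)
open import Data.Bool.Properties using (∨-identityʳ; ∧-comm)
open import Data.Empty using (⊥-elim)
open import Data.Fin using (Fin; toℕ; fromℕ<; _↑ˡ_; _↑ʳ_; punchOut)
  renaming (_≟_ to _≟F_; zero to fzero; suc to fsuc)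
open import Data.Fin.Properties
  using (any?; toℕ-↑ˡ; toℕ-↑ʳ; pigeonhole; punchOut-injective; toℕ-injective; toℕ-fromℕ<; toℕ<n)
  renaming (suc-injective to fsuc-injective; <⇒≢ to <⇒≢ᶠ)
open import Data.List using (List; []; _∷_; map; _++_; concat; tabulate)
open import Data.List.Membership.Propositional using (_∈_)
open import Data.List.Membership.Propositional.Properties using (∈-map⁻)
open import Data.List.Properties using (map-++; map-∘; map-cong)
open import Data.List.Relation.Unary.Any using (here; there)
open import Data.Maybe using (Maybe; just; nothing; fromMaybe)
open import Data.Nat.DivMod using (_/_; +-distrib-/-∣ˡ; m*n/n≡m; m<n⇒m/n≡0; n/n≡1; m<n*o⇒m/o<n)
open import Data.Nat.Divisibility using (m∣m*n; ∣-refl)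
open import Data.Nat.ListAction using (sum)
open import Data.Nat.ListAction.Properties using (sum-++)
open import Data.Nat.Properties
open import Data.Product.Properties using (≡-dec)
open import Data.Sum using (_⊎_; inj₁; inj₂)
open import Data.Vec using (lookup; toList) renaming (_∷_ to _∷ᵥ_; [] to []ᵥ)
import Data.Vec.Membership.Propositional as Vec
open import Data.Vec.Membership.Propositional.Properties using (∈-lookup; ∈-toList⁺; ∈-toList⁻)
open import Data.Vec.Relation.Unary.Any using (index)
open import Data.Vec.Relation.Unary.Any.Properties using (lookup-index)
open import Function.Base using (_∘_)
open import Relation.Binary.PropositionalEquality
open import Relation.Nullary using (¬_; ¬?; Dec; yes; no; does)
open import Relation.Nullary.Decidable using (_×-dec_; dec-true; dec-false; does-⇔)

indicator : {A : Set} → Dec A → ℕ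
indicator a? = if does a? then 1 else 0

indicator-yes : {A : Set} (a? : Dec A) → A → indicator a? ≡ 1
indicator-yes a? a = cong (λ b → if b then 1 else 0) (dec-true a? a)

indicator-no : {A : Set} (a? : Dec A) → ¬ A → indicator a? ≡ 0
indicator-no a? ¬a = cong (λ b → if b then 1 else 0) (dec-false a? ¬a)

indicator≡1⇒ : {A : Set} (a? : Dec A) → indicator a? ≡ 1 → A
indicator≡1⇒ (yes a) _ = a

indicator≢0⇒ : {A : Set} (a? : Dec A) → indicator a? ≢ 0 → A
indicator≢0⇒ (yes a) _ = a
indicator≢0⇒ (no _) 0≢0 = ⊥-elim (0≢0 refl)

indicator≤1 : {A : Set} (a? : Dec A) → indicator a? ≤ 1
indicator≤1 (yes _) = ≤-refl
indicator≤1 (no _) = z≤n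

indicator-⇔ : {A B : Set} (a? : Dec A) (b? : Dec B) → A ⇔ B → indicator a? ≡ indicator b?
indicator-⇔ a? b? A⇔B = cong (λ b → if b then 1 else 0) (does-⇔ A⇔B a? b?)

m+n≡1⇒ : ∀ m {n} → m + n ≡ 1 → (m ≡ 0 × n ≡ 1) ⊎ (m ≡ 1 × n ≡ 0)
m+n≡1⇒ 0 eq = inj₁ (refl , eq)
m+n≡1⇒ 1 eq = inj₂ (refl , suc-injective eq)
m+n≡1⇒ (suc (suc m)) ()

does≡true⇒ : {A : Set} (a? : Dec A) → does a? ≡ true → A
does≡true⇒ (yes a) _ = a

[m*n+o]/m≡n : ∀ m n {o} .{{_ : NonZero m}} → o < m → (m * n + o) / m ≡ n
[m*n+o]/m≡n m n {o} o<m = begin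
  (m * n + o) / m    ≡⟨ +-distrib-/-∣ˡ o (m∣m*n n) ⟩
  m * n / m + o / m  ≡⟨ cong₂ _+_ (trans (cong (_/ m) (*-comm m n)) (m*n/n≡m n m)) (m<n⇒m/n≡0 o<m) ⟩
  n + 0              ≡⟨ +-identityʳ n ⟩
  n                  ∎
  where open ≡-Reasoning

[n+m]/n≡1+m/n : ∀ n m .{{_ : NonZero n}} → (n + m) / n ≡ suc (m / n)
[n+m]/n≡1+m/n n m = trans (+-distrib-/-∣ˡ m ∣-refl) (cong (_+ m / n) (n/n≡1 n))

m+n≡o⇒m≡o∸n : ∀ m n {o} → m + n ≡ o → m ≡ o ∸ n
m+n≡o⇒m≡o∸n m n eq = trans (sym (m+n∸n≡m m n)) (cong (_∸ n) eq)

if≢0⇒ : ∀ b {a} → (if b then a else 0) ≢ 0 → b ≡ true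
if≢0⇒ true _ = refl
if≢0⇒ false 0≢0 = ⊥-elim (0≢0 refl)

∈⇒≤sum-map : {A : Set} (f : A → ℕ) {x : A} {xs : List A} → x ∈ xs → f x ≤ sum (map f xs)
∈⇒≤sum-map f (here refl) = m≤m+n _ _
∈⇒≤sum-map f {xs = y ∷ ys} (there x∈ys) = ≤-trans (∈⇒≤sum-map f x∈ys) (m≤n+m _ (f y))

module Decompositions (h w : ℕ) (2≤h : 2 ≤ h) (2≤w : 2 ≤ w) where
  open Sudoku h w 2≤h 2≤w

  instance
    h-nonZero : NonZero h
    h-nonZero = >-nonZero (≤-trans (s≤s z≤n) 2≤h)
    w-nonZero : NonZero w
    w-nonZero = >-nonZero (≤-trans (s≤s z≤n) 2≤w)

  -- Finite sums

  sumFin-cong : ∀ {m} {f g : Fin m → ℕ} → (∀ x → f x ≡ g x) → sumFin f ≡ sumFin g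
  sumFin-cong {0} _ = refl
  sumFin-cong {suc m} f≗g = cong₂ _+_ (f≗g fzero) (sumFin-cong (f≗g ∘ fsuc))

  sumFin-+ : ∀ {m} (f g : Fin m → ℕ) → sumFin (λ x → f x + g x) ≡ sumFin f + sumFin g
  sumFin-+ {0} f g = refl
  sumFin-+ {suc m} f g = begin
    f fzero + g fzero + sumFin (λ x → f (fsuc x) + g (fsuc x))
      ≡⟨ cong (f fzero + g fzero +_) (sumFin-+ (f ∘ fsuc) (g ∘ fsuc)) ⟩
    f fzero + g fzero + (sumFin (f ∘ fsuc) + sumFin (g ∘ fsuc))
      ≡⟨ interchange +-commutativeSemigroup (f fzero) (g fzero) _ _ ⟩
    f fzero + sumFin (f ∘ fsuc) + (g fzero + sumFin (g ∘ fsuc)) ∎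
    where open ≡-Reasoning

  sumFin-zero : ∀ {m} {f : Fin m → ℕ} → (∀ x → f x ≡ 0) → sumFin f ≡ 0
  sumFin-zero {0} _ = refl
  sumFin-zero {suc m} f≗0 = cong₂ _+_ (f≗0 fzero) (sumFin-zero (f≗0 ∘ fsuc))

  sumFin≡0⇒ : ∀ {m} {f : Fin m → ℕ} → sumFin f ≡ 0 → ∀ x → f x ≡ 0
  sumFin≡0⇒ {suc m} {f} eq fzero = m+n≡0⇒m≡0 (f fzero) eq
  sumFin≡0⇒ {suc m} {f} eq (fsuc x) = sumFin≡0⇒ (m+n≡0⇒n≡0 (f fzero) eq) x

  sumFin-single : ∀ {m} {f : Fin m → ℕ} x → (∀ y → y ≢ x → f y ≡ 0) → sumFin f ≡ f x
  sumFin-single {suc m} {f} fzero others =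
    trans (cong (f fzero +_) (sumFin-zero (λ y → others (fsuc y) λ ()))) (+-identityʳ (f fzero))
  sumFin-single {suc m} {f} (fsuc x) others =
    cong₂ _+_ (others fzero λ ()) (sumFin-single x (λ y y≢x → others (fsuc y) (y≢x ∘ fsuc-injective)))

  sumFin≡1⇒ : ∀ {m} {f : Fin m → ℕ} → sumFin f ≡ 1 →
              Σ (Fin m) λ x → f x ≡ 1 × (∀ y → y ≢ x → f y ≡ 0)
  sumFin≡1⇒ {suc m} {f} eq with m+n≡1⇒ (f fzero) eq
  ... | inj₂ (f₀≡1 , rest≡0) = fzero , f₀≡1 , λ where
          fzero 0≢0 → ⊥-elim (0≢0 refl)
          (fsuc y) _ → sumFin≡0⇒ rest≡0 y
  ... | inj₁ (f₀≡0 , rest≡1) with x , fx≡1 , others ← sumFin≡1⇒ rest≡1 =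
    fsuc x , fx≡1 , λ where
      fzero _ → f₀≡0
      (fsuc y) y≢x → others y (y≢x ∘ cong fsuc)

  sumFin-const : ∀ m c → sumFin {m} (λ _ → c) ≡ m * c
  sumFin-const 0 c = refl
  sumFin-const (suc m) c = cong (c +_) (sumFin-const m c)

  sumFin-*ˡ : ∀ {m} c (f : Fin m → ℕ) → sumFin (λ x → c * f x) ≡ c * sumFin f
  sumFin-*ˡ {0} c f = sym (*-zeroʳ c)
  sumFin-*ˡ {suc m} c f =
    trans (cong (c * f fzero +_) (sumFin-*ˡ c (f ∘ fsuc))) (sym (*-distribˡ-+ c (f fzero) _))

  sumFin-++ : ∀ a {b} (f : Fin (a + b) → ℕ) → sumFin f ≡ sumFin (f ∘ (_↑ˡ b)) + sumFin (f ∘ (a ↑ʳ_))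
  sumFin-++ 0 f = refl
  sumFin-++ (suc a) f = trans (cong (f fzero +_) (sumFin-++ a (f ∘ fsuc))) (sym (+-assoc (f fzero) _ _))

  sumFin-blocks : ∀ m d .{{_ : NonZero d}} (g : ℕ → ℕ) →
                  sumFin {m * d} (λ x → g (toℕ x / d)) ≡ sumFin {m} (λ k → d * g (toℕ k))
  sumFin-blocks 0 d g = refl
  sumFin-blocks (suc m) d g = begin
    sumFin {d + m * d} (λ x → g (toℕ x / d))
      ≡⟨ sumFin-++ d (λ x → g (toℕ x / d)) ⟩
    sumFin {d} (λ x → g (toℕ (x ↑ˡ m * d) / d)) + sumFin {m * d} (λ x → g (toℕ (d ↑ʳ x) / d))
      ≡⟨ cong₂ _+_ (sumFin-cong firstBlock) (sumFin-cong laterBlocks) ⟩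
    sumFin {d} (λ _ → g 0) + sumFin {m * d} (λ x → g (suc (toℕ x / d)))
      ≡⟨ cong₂ _+_ (sumFin-const d (g 0)) (sumFin-blocks m d (g ∘ suc)) ⟩
    d * g 0 + sumFin {m} (λ k → d * g (suc (toℕ k))) ∎
    where
    open ≡-Reasoning
    firstBlock : ∀ (x : Fin d) → g (toℕ (x ↑ˡ m * d) / d) ≡ g 0
    firstBlock x = cong g (trans (cong (_/ d) (toℕ-↑ˡ x (m * d))) (m<n⇒m/n≡0 (toℕ<n x)))
    laterBlocks : ∀ (x : Fin (m * d)) → g (toℕ (d ↑ʳ x) / d) ≡ g (suc (toℕ x / d))
    laterBlocks x = cong g (trans (cong (_/ d) (toℕ-↑ʳ d x)) ([n+m]/n≡1+m/n d (toℕ x)))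

  blockSize : ∀ {N} m d .{{_ : NonZero d}} q → N ≡ m * d → q < m →
              sumFin {N} (λ x → indicator (toℕ x / d ≟ q)) ≡ d
  blockSize m d q refl q<m = begin
    sumFin {m * d} (λ x → indicator (toℕ x / d ≟ q))
      ≡⟨ sumFin-blocks m d (λ y → indicator (y ≟ q)) ⟩
    sumFin {m} (λ k → d * indicator (toℕ k ≟ q))
      ≡⟨ sumFin-single (fromℕ< q<m) otherBlocks ⟩
    d * indicator (toℕ (fromℕ< q<m) ≟ q)
      ≡⟨ cong (d *_) (indicator-yes (toℕ (fromℕ< q<m) ≟ q) (toℕ-fromℕ< q<m)) ⟩
    d * 1
      ≡⟨ *-identityʳ d ⟩
    d ∎
    where
    open ≡-Reasoning
    otherBlocks : ∀ k → k ≢ fromℕ< q<m → d * indicator (toℕ k ≟ q) ≡ 0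
    otherBlocks k k≢q = trans (cong (d *_) (indicator-no (toℕ k ≟ q)
      λ k≡q → k≢q (toℕ-injective (trans k≡q (sym (toℕ-fromℕ< q<m)))))) (*-zeroʳ d)

  ∑cells : (Fin n → Fin n → ℕ) → ℕ
  ∑cells f = sumFin λ i → sumFin λ j → f i j

  ∑cells-cong : ∀ {f g : Fin n → Fin n → ℕ} → (∀ i j → f i j ≡ g i j) → ∑cells f ≡ ∑cells g
  ∑cells-cong f≗g = sumFin-cong λ i → sumFin-cong (f≗g i)

  ∑cells-+ : ∀ (f g : Fin n → Fin n → ℕ) → ∑cells (λ i j → f i j + g i j) ≡ ∑cells f + ∑cells g
  ∑cells-+ f g =
    trans (sumFin-cong λ i → sumFin-+ (f i) (g i)) (sumFin-+ (λ i → sumFin (f i)) (λ i → sumFin (g i)))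

  ∑cells-*ˡ : ∀ c (f : Fin n → Fin n → ℕ) → ∑cells (λ i j → c * f i j) ≡ c * ∑cells f
  ∑cells-*ˡ c f = trans (sumFin-cong λ i → sumFin-*ˡ c (f i)) (sumFin-*ˡ c (λ i → sumFin (f i)))

  ∑cells-zero : ∀ {f : Fin n → Fin n → ℕ} → (∀ i j → f i j ≡ 0) → ∑cells f ≡ 0
  ∑cells-zero f≗0 = sumFin-zero λ i → sumFin-zero (f≗0 i)

  ∑cells-single : ∀ {f : Fin n → Fin n → ℕ} i j → (∀ i' j' → (i' , j') ≢ (i , j) → f i' j' ≡ 0) →
                  ∑cells f ≡ f i j
  ∑cells-single i j others =
    trans (sumFin-single i λ i' i'≢i → sumFin-zero λ j' → others i' j' (i'≢i ∘ cong proj₁))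
          (sumFin-single j λ j' j'≢j → others i j' (j'≢j ∘ cong proj₂))

  ∑cells≡1⇒ : ∀ {f : Fin n → Fin n → ℕ} → ∑cells f ≡ 1 →
              Σ (Fin n × Fin n) λ (i , j) → f i j ≡ 1 × (∀ i' j' → (i' , j') ≢ (i , j) → f i' j' ≡ 0)
  ∑cells≡1⇒ {f} eq with sumFin≡1⇒ {f = λ i → sumFin (f i)} eq
  ... | i , row≡1 , otherRows with sumFin≡1⇒ {f = f i} row≡1
  ...   | j , fij≡1 , otherCols = (i , j) , fij≡1 , others
    where
    others : ∀ i' j' → (i' , j') ≢ (i , j) → f i' j' ≡ 0
    others i' j' ne with i' ≟F i
    ... | yes refl = otherCols j' (ne ∘ cong (i ,_))
    ... | no i'≢i = sumFin≡0⇒ (otherRows i' i'≢i) j'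

  ∑cells≤1 : ∀ {f : Fin n → Fin n → ℕ} → (∀ i j → f i j ≤ 1) →
             (∀ i j i' j' → f i j ≢ 0 → f i' j' ≢ 0 → (i , j) ≡ (i' , j')) → ∑cells f ≤ 1
  ∑cells≤1 {f} f≤1 unique with any? (λ i → any? λ j → ¬? (f i j ≟ 0))
  ... | yes (i , j , fij≢0) = ≤-trans (≤-reflexive (∑cells-single i j others)) (f≤1 i j)
    where
    others : ∀ i' j' → (i' , j') ≢ (i , j) → f i' j' ≡ 0
    others i' j' ne with f i' j' ≟ 0
    ... | yes eq = eq
    ... | no f'≢0 = ⊥-elim (ne (sym (unique i j i' j' fij≢0 f'≢0)))
  ... | no none = ≤-trans (≤-reflexive (∑cells-zero allZero)) z≤n
    where
    allZero : ∀ i j → f i j ≡ 0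
    allZero i j with f i j ≟ 0
    ... | yes eq = eq
    ... | no fij≢0 = ⊥-elim (none (i , j , fij≢0))

  UniqueCell : (Fin n → Fin n → Set) → Set
  UniqueCell P = Σ (Fin n × Fin n) λ (i , j) → P i j × (∀ i' j' → P i' j' → (i' , j') ≡ (i , j))

  _≟C_ : (c c' : Fin n × Fin n) → Dec (c ≡ c')
  _≟C_ = ≡-dec _≟F_ _≟F_

  ∑cells-indicator≡1⇔ : ∀ {P : Fin n → Fin n → Set} (P? : ∀ i j → Dec (P i j)) →
                        ∑cells (λ i j → indicator (P? i j)) ≡ 1 ⇔ UniqueCell P
  ∑cells-indicator≡1⇔ {P} P? = mk⇔ to from
    where
    to : ∑cells (λ i j → indicator (P? i j)) ≡ 1 → UniqueCell P
    to eq with (i , j) , Pij≡1 , others ← ∑cells≡1⇒ eq =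
      (i , j) , indicator≡1⇒ (P? i j) Pij≡1 , unique
      where
      unique : ∀ i' j' → P i' j' → (i' , j') ≡ (i , j)
      unique i' j' p with (i' , j') ≟C (i , j)
      ... | yes eq = eq
      ... | no ne = ⊥-elim (1+n≢0 (trans (sym (indicator-yes (P? i' j') p)) (others i' j' ne)))
    from : UniqueCell P → ∑cells (λ i j → indicator (P? i j)) ≡ 1
    from ((i , j) , p , unique) =
      trans (∑cells-single i j λ i' j' ne → indicator-no (P? i' j') (ne ∘ unique i' j'))
            (indicator-yes (P? i j) p)

  Cell : Set
  Cell = Fin n × Fin n × Fin n

  coord : Kind → Cell → Fin n
  coord R (i , j , k) = i
  coord C (i , j , k) = j
  coord B (i , j , k) = box i j
  coord Sy (i , j , k) = k

  open import Data.List.Membership.DecPropositional _≟V_ using () renaming (_∈?_ to _∈ᵈ?_)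

  ∈?≡does : ∀ u l → u ∈? l ≡ does (u ∈ᵈ? l)
  ∈?≡does u [] = refl
  ∈?≡does u (x ∷ l) = cong (does (u ≟V x) ∨_) (∈?≡does u l)

  ∈?-true : ∀ {u l} → u ∈ l → u ∈? l ≡ true
  ∈?-true {u} {l} u∈l = trans (∈?≡does u l) (dec-true (u ∈ᵈ? l) u∈l)

  ∈?-cellVerts : ∀ K x i j k → (K , x) ∈? cellVerts i j k ≡ does (x ≟F coord K (i , j , k))
  ∈?-cellVerts R x i j k = ∨-identityʳ _
  ∈?-cellVerts C x i j k = ∨-identityʳ _
  ∈?-cellVerts B x i j k = ∨-identityʳ _
  ∈?-cellVerts Sy x i j k = ∨-identityʳ _

  cliqueEdge-coord : ∀ t K x K' y →
                     cliqueEdge t (K , x) (K' , y) ≡ indicator ((x ≟F coord K t) ×-dec (y ≟F coord K' t))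
  cliqueEdge-coord (i , j , k) K x K' y =
    cong₂ (λ a b → if a ∧ b then 1 else 0) (∈?-cellVerts K x i j k) (∈?-cellVerts K' y i j k)

  cliqueEdge-sym : ∀ t u v → cliqueEdge t u v ≡ cliqueEdge t v u
  cliqueEdge-sym (i , j , k) u v =
    cong (λ b → if b then 1 else 0) (∧-comm (u ∈? cellVerts i j k) (v ∈? cellVerts i j k))

  tileEdge≡adj*cliqueEdge : ∀ t u v → tileEdge t u v ≡ adj u v * cliqueEdge t u v
  tileEdge≡adj*cliqueEdge (i , j , k) u v = if-scale ((u ∈? cellVerts i j k) ∧ (v ∈? cellVerts i j k))
    where
    if-scale : ∀ b → (if b then adj u v else 0) ≡ adj u v * (if b then 1 else 0)
    if-scale true = sym (*-identityʳ (adj u v))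
    if-scale false = sym (*-zeroʳ (adj u v))

  adj*adj*≡adj : ∀ u v → adj u v * adj* u v ≡ adj u v
  adj*adj*≡adj (R , _) (R , _) = refl
  adj*adj*≡adj (R , _) (C , _) = refl
  adj*adj*≡adj (R , _) (B , _) = refl
  adj*adj*≡adj (R , _) (Sy , _) = refl
  adj*adj*≡adj (C , _) (R , _) = refl
  adj*adj*≡adj (C , _) (C , _) = refl
  adj*adj*≡adj (C , _) (B , _) = refl
  adj*adj*≡adj (C , _) (Sy , _) = refl
  adj*adj*≡adj (B , _) (R , _) = refl
  adj*adj*≡adj (B , _) (C , _) = refl
  adj*adj*≡adj (B , _) (B , _) = refl
  adj*adj*≡adj (B , _) (Sy , _) = refl
  adj*adj*≡adj (Sy , _) (R , _) = refl
  adj*adj*≡adj (Sy , _) (C , _) = refl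
  adj*adj*≡adj (Sy , _) (B , _) = refl
  adj*adj*≡adj (Sy , _) (Sy , _) = refl


  adj*-same-kind : ∀ K x y → adj* (K , x) (K , y) ≡ 0
  adj*-same-kind R x y = refl
  adj*-same-kind C x y = refl
  adj*-same-kind B x y = refl
  adj*-same-kind Sy x y = refl

  kindAt : Fin 4 → Kind
  kindAt fzero = R
  kindAt (fsuc fzero) = C
  kindAt (fsuc (fsuc fzero)) = B
  kindAt (fsuc (fsuc (fsuc fzero))) = Sy

  kindIndex : Kind → Fin 4
  kindIndex R = fzero
  kindIndex C = fsuc fzero
  kindIndex B = fsuc (fsuc fzero)
  kindIndex Sy = fsuc (fsuc (fsuc fzero))

  kindIndex-kindAt : ∀ p → kindIndex (kindAt p) ≡ p
  kindIndex-kindAt fzero = refl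
  kindIndex-kindAt (fsuc fzero) = refl
  kindIndex-kindAt (fsuc (fsuc fzero)) = refl
  kindIndex-kindAt (fsuc (fsuc (fsuc fzero))) = refl

  kindAt-kindIndex : ∀ K → kindAt (kindIndex K) ≡ K
  kindAt-kindIndex R = refl
  kindAt-kindIndex C = refl
  kindAt-kindIndex B = refl
  kindAt-kindIndex Sy = refl

  kindIndex-injective : ∀ {K K'} → kindIndex K ≡ kindIndex K' → K ≡ K'
  kindIndex-injective {K} {K'} eq = trans (sym (kindAt-kindIndex K)) (trans (cong kindAt eq) (kindAt-kindIndex K'))

  toQuad : Cell → Quad
  toQuad (i , j , k) = (R , i) ∷ᵥ (C , j) ∷ᵥ (B , box i j) ∷ᵥ (Sy , k) ∷ᵥ []ᵥ

  kind-toQuad : ∀ t p → proj₁ (lookup (toQuad t) p) ≡ kindAt p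
  kind-toQuad t fzero = refl
  kind-toQuad t (fsuc fzero) = refl
  kind-toQuad t (fsuc (fsuc fzero)) = refl
  kind-toQuad t (fsuc (fsuc (fsuc fzero))) = refl

  toQuad-distinct : ∀ t → Distinct (toQuad t)
  toQuad-distinct t p p' p≢p' same = p≢p' (begin
    p                                         ≡⟨ kindIndex-kindAt p ⟨
    kindIndex (kindAt p)                      ≡⟨ cong kindIndex (kind-toQuad t p) ⟨
    kindIndex (proj₁ (lookup (toQuad t) p))   ≡⟨ cong (kindIndex ∘ proj₁) same ⟩
    kindIndex (proj₁ (lookup (toQuad t) p'))  ≡⟨ cong kindIndex (kind-toQuad t p') ⟩
    kindIndex (kindAt p')                     ≡⟨ kindIndex-kindAt p' ⟩
    p'                                        ∎)
    where open ≡-Reasoning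

  quadEdge-toQuad : ∀ t u v → quadEdge (toQuad t) u v ≡ cliqueEdge t u v
  quadEdge-toQuad (i , j , k) u v = refl

  toℕ-box : ∀ i j → toℕ (box i j) ≡ h * (toℕ i / h) + toℕ j / w
  toℕ-box i j = toℕ-fromℕ< (boxℕ<n i j)

  toℕ/w<h : ∀ (j : Fin n) → toℕ j / w < h
  toℕ/w<h j = m<n*o⇒m/o<n {n = h} (toℕ<n j)

  toℕ/h<w : ∀ (i : Fin n) → toℕ i / h < w
  toℕ/h<w i = m<n*o⇒m/o<n {n = w} (≤-trans (toℕ<n i) (≤-reflexive (*-comm h w)))

  box-sameRow⇔ : ∀ i j j' → box i j ≡ box i j' ⇔ toℕ j / w ≡ toℕ j' / w
  box-sameRow⇔ i j j' = mk⇔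
    (λ eq → +-cancelˡ-≡ (h * (toℕ i / h)) _ _
              (trans (sym (toℕ-box i j)) (trans (cong toℕ eq) (toℕ-box i j'))))
    (λ eq → toℕ-injective
              (trans (toℕ-box i j) (trans (cong (h * (toℕ i / h) +_) eq) (sym (toℕ-box i j')))))

  box-sameCol⇔ : ∀ i i' j → box i j ≡ box i' j ⇔ toℕ i / h ≡ toℕ i' / h
  box-sameCol⇔ i i' j = mk⇔
    (λ eq → *-cancelˡ-≡ _ _ h (+-cancelʳ-≡ (toℕ j / w) _ _
              (trans (sym (toℕ-box i j)) (trans (cong toℕ eq) (toℕ-box i' j)))))
    (λ eq → toℕ-injective
              (trans (toℕ-box i j) (trans (cong (λ a → h * a + toℕ j / w) eq) (sym (toℕ-box i' j)))))

  box-incident : ∀ i j ℓ → rowInc i ℓ ≡ true → colInc j ℓ ≡ true → box i j ≡ ℓ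
  box-incident i j ℓ rowInc≡true colInc≡true
    with j₀ , boxij₀≡ℓ ← does≡true⇒ (any? λ j' → box i j' ≟F ℓ) rowInc≡true
       | i₀ , boxi₀j≡ℓ ← does≡true⇒ (any? λ i' → box i' j ≟F ℓ) colInc≡true =
    trans (Equivalence.from (box-sameCol⇔ i i₀ j) sameBand) boxi₀j≡ℓ
    where
    sameBand : toℕ i / h ≡ toℕ i₀ / h
    sameBand = begin
      toℕ i / h
        ≡⟨ [m*n+o]/m≡n h (toℕ i / h) (toℕ/w<h j₀) ⟨
      (h * (toℕ i / h) + toℕ j₀ / w) / h
        ≡⟨ cong (_/ h) (trans (sym (toℕ-box i j₀)) (cong toℕ boxij₀≡ℓ)) ⟩
      toℕ ℓ / h
        ≡⟨ cong (_/ h) (trans (cong toℕ (sym boxi₀j≡ℓ)) (toℕ-box i₀ j)) ⟩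
      (h * (toℕ i₀ / h) + toℕ j / w) / h
        ≡⟨ [m*n+o]/m≡n h (toℕ i₀ / h) (toℕ/w<h j) ⟩
      toℕ i₀ / h ∎
      where open ≡-Reasoning

  rowIncidence : ∀ x ℓ → sumFin (λ j → indicator (ℓ ≟F box x j)) ≡ (if rowInc x ℓ then w else 0)
  rowIncidence x ℓ = count (any? λ j → box x j ≟F ℓ)
    where
    count : (inc? : Dec (∃ λ j → box x j ≡ ℓ)) →
            sumFin (λ j → indicator (ℓ ≟F box x j)) ≡ (if does inc? then w else 0)
    count (yes (j₀ , boxxj₀≡ℓ)) = trans
      (sumFin-cong λ j → indicator-⇔ (ℓ ≟F box x j) (toℕ j / w ≟ toℕ j₀ / w) (sameBox j))
      (blockSize h w (toℕ j₀ / w) refl (toℕ/w<h j₀))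
      where
      sameBox : ∀ j → ℓ ≡ box x j ⇔ toℕ j / w ≡ toℕ j₀ / w
      sameBox j = mk⇔
        (λ ℓ≡box → Equivalence.to (box-sameRow⇔ x j j₀) (sym (trans boxxj₀≡ℓ ℓ≡box)))
        (λ eq → trans (sym boxxj₀≡ℓ) (sym (Equivalence.from (box-sameRow⇔ x j j₀) eq)))
    count (no none) = sumFin-zero λ j → indicator-no (ℓ ≟F box x j) λ ℓ≡box → none (j , sym ℓ≡box)

  colIncidence : ∀ y ℓ → sumFin (λ i → indicator (ℓ ≟F box i y)) ≡ (if colInc y ℓ then h else 0)
  colIncidence y ℓ = count (any? λ i → box i y ≟F ℓ)
    where
    count : (inc? : Dec (∃ λ i → box i y ≡ ℓ)) →
            sumFin (λ i → indicator (ℓ ≟F box i y)) ≡ (if does inc? then h else 0)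
    count (yes (i₀ , boxi₀y≡ℓ)) = trans
      (sumFin-cong λ i → indicator-⇔ (ℓ ≟F box i y) (toℕ i / h ≟ toℕ i₀ / h) (sameBox i))
      (blockSize w h (toℕ i₀ / h) (*-comm h w) (toℕ/h<w i₀))
      where
      sameBox : ∀ i → ℓ ≡ box i y ⇔ toℕ i / h ≡ toℕ i₀ / h
      sameBox i = mk⇔
        (λ ℓ≡box → Equivalence.to (box-sameCol⇔ i i₀ y) (sym (trans boxi₀y≡ℓ ℓ≡box)))
        (λ eq → trans (sym boxi₀y≡ℓ) (sym (Equivalence.from (box-sameCol⇔ i i₀ y) eq)))
    count (no none) = sumFin-zero λ i → indicator-no (ℓ ≟F box i y) λ ℓ≡box → none (i , sym ℓ≡box)

  -- Edges covered by the cells of a grid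

  Grid : Set
  Grid = Fin n → Fin n → Fin n

  coverCount : (Cell → V → V → ℕ) → Grid → V → V → ℕ
  coverCount e L u v = ∑cells λ i j → e (i , j , L i j) u v

  cliqueCount-sym : ∀ L u v → coverCount cliqueEdge L u v ≡ coverCount cliqueEdge L v u
  cliqueCount-sym L u v = ∑cells-cong λ i j → cliqueEdge-sym (i , j , L i j) u v

  tileCount≡adj*cliqueCount : ∀ L u v → coverCount tileEdge L u v ≡ adj u v * coverCount cliqueEdge L u v
  tileCount≡adj*cliqueCount L u v =
    trans (∑cells-cong λ i j → tileEdge≡adj*cliqueEdge (i , j , L i j) u v)
          (∑cells-*ˡ (adj u v) (λ i j → cliqueEdge (i , j , L i j) u v))

  cliqueCount≡tileCount : ∀ L u v → adj u v ≡ 1 → coverCount cliqueEdge L u v ≡ coverCount tileEdge L u v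
  cliqueCount≡tileCount L u v adj≡1 = sym (begin
    coverCount tileEdge L u v               ≡⟨ tileCount≡adj*cliqueCount L u v ⟩
    adj u v * coverCount cliqueEdge L u v   ≡⟨ cong (_* coverCount cliqueEdge L u v) adj≡1 ⟩
    1 * coverCount cliqueEdge L u v         ≡⟨ *-identityˡ _ ⟩
    coverCount cliqueEdge L u v             ∎)
    where open ≡-Reasoning

  CoveredOnce : Grid → Kind → Fin n → Kind → Fin n → Set
  CoveredOnce L K x K' y = UniqueCell λ i j → x ≡ coord K (i , j , L i j) × y ≡ coord K' (i , j , L i j)

  cliqueCount≡1⇔ : ∀ L K x K' y → coverCount cliqueEdge L (K , x) (K' , y) ≡ 1 ⇔ CoveredOnce L K x K' y
  cliqueCount≡1⇔ L K x K' y = subst (λ c → c ≡ 1 ⇔ CoveredOnce L K x K' y)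
    (sym (∑cells-cong λ i j → cliqueEdge-coord (i , j , L i j) K x K' y))
    (∑cells-indicator≡1⇔ λ i j → (x ≟F coord K (i , j , L i j)) ×-dec (y ≟F coord K' (i , j , L i j)))

  cliqueCount-same-kind : ∀ L K x y → x ≢ y → coverCount cliqueEdge L (K , x) (K , y) ≡ 0
  cliqueCount-same-kind L K x y x≢y = ∑cells-zero λ i j → trans
    (cliqueEdge-coord (i , j , L i j) K x K y)
    (indicator-no ((x ≟F _) ×-dec (y ≟F _)) λ (x≡ , y≡) → x≢y (trans x≡ (sym y≡)))

  rowColCoveredOnce : ∀ L x y → CoveredOnce L R x C y
  rowColCoveredOnce L x y = (x , y) , (refl , refl) , λ { _ _ (refl , refl) → refl }

  SymbolsCoveredOnce : Grid → Set
  SymbolsCoveredOnce L = ∀ x k → CoveredOnce L R x Sy k × CoveredOnce L C x Sy k × CoveredOnce L B x Sy k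

  isSudoku⇔ : ∀ L → IsSudoku L ⇔ SymbolsCoveredOnce L
  isSudoku⇔ L = mk⇔ to from
    where
    to : IsSudoku L → SymbolsCoveredOnce L
    to (rows , cols , boxes) x k
      with j , Lxj≡k , uniqueʳ ← rows x k
         | i , Lix≡k , uniqueᶜ ← cols x k
         | (i′ , j′) , box≡x , L≡k , uniqueᵇ ← boxes x k =
        ((x , j) , (refl , sym Lxj≡k) , λ { _ j' (refl , k≡L) → cong (x ,_) (uniqueʳ j' (sym k≡L)) })
      , ((i , x) , (refl , sym Lix≡k) , λ { i' _ (refl , k≡L) → cong (_, x) (uniqueᶜ i' (sym k≡L)) })
      , ((i′ , j′) , (sym box≡x , sym L≡k) ,
         λ i' j' (x≡box , k≡L) → uniqueᵇ i' j' (sym x≡box) (sym k≡L))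
    from : SymbolsCoveredOnce L → IsSudoku L
    from once = row , col , box′
      where
      row : ∀ i k → Σ (Fin n) λ j → L i j ≡ k × (∀ j' → L i j' ≡ k → j' ≡ j)
      row i k with (_ , j) , (refl , k≡L) , unique ← proj₁ (once i k) =
        j , sym k≡L , λ j' L≡k → cong proj₂ (unique i j' (refl , sym L≡k))
      col : ∀ j k → Σ (Fin n) λ i → L i j ≡ k × (∀ i' → L i' j ≡ k → i' ≡ i)
      col j k with (i , _) , (refl , k≡L) , unique ← proj₁ (proj₂ (once j k)) =
        i , sym k≡L , λ i' L≡k → cong proj₁ (unique i' j (refl , sym L≡k))
      box′ : ∀ ℓ k → Σ (Fin n × Fin n) λ { (i , j) → box i j ≡ ℓ × L i j ≡ k
               × (∀ i' j' → box i' j' ≡ ℓ → L i' j' ≡ k → (i' , j') ≡ (i , j)) }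
      box′ ℓ k with (i , j) , (ℓ≡box , k≡L) , unique ← proj₂ (proj₂ (once ℓ k)) =
        (i , j) , sym ℓ≡box , sym k≡L , λ i' j' box≡ℓ L≡k → unique i' j' (sym box≡ℓ , sym L≡k)

  cliqueCount-row-box : ∀ L x ℓ → coverCount cliqueEdge L (R , x) (B , ℓ) ≡ adj* (R , x) (B , ℓ)
  cliqueCount-row-box L x ℓ = begin
    coverCount cliqueEdge L (R , x) (B , ℓ)
      ≡⟨ ∑cells-cong (λ i j → cliqueEdge-coord (i , j , L i j) R x B ℓ) ⟩
    ∑cells (λ i j → indicator ((x ≟F i) ×-dec (ℓ ≟F box i j)))
      ≡⟨ sumFin-single x (λ i i≢x → sumFin-zero λ j →
           indicator-no ((x ≟F i) ×-dec (ℓ ≟F box i j)) (λ (x≡i , _) → i≢x (sym x≡i))) ⟩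
    sumFin (λ j → indicator ((x ≟F x) ×-dec (ℓ ≟F box x j)))
      ≡⟨ sumFin-cong (λ j →
           indicator-⇔ ((x ≟F x) ×-dec (ℓ ≟F box x j)) (ℓ ≟F box x j) (mk⇔ proj₂ (refl ,_))) ⟩
    sumFin (λ j → indicator (ℓ ≟F box x j))
      ≡⟨ rowIncidence x ℓ ⟩
    adj* (R , x) (B , ℓ) ∎
    where open ≡-Reasoning

  cliqueCount-col-box : ∀ L y ℓ → coverCount cliqueEdge L (C , y) (B , ℓ) ≡ adj* (C , y) (B , ℓ)
  cliqueCount-col-box L y ℓ = begin
    coverCount cliqueEdge L (C , y) (B , ℓ)
      ≡⟨ ∑cells-cong (λ i j → cliqueEdge-coord (i , j , L i j) C y B ℓ) ⟩
    ∑cells (λ i j → indicator ((y ≟F j) ×-dec (ℓ ≟F box i j)))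
      ≡⟨ sumFin-cong (λ i → sumFin-single y λ j j≢y →
           indicator-no ((y ≟F j) ×-dec (ℓ ≟F box i j)) (λ (y≡j , _) → j≢y (sym y≡j))) ⟩
    sumFin (λ i → indicator ((y ≟F y) ×-dec (ℓ ≟F box i y)))
      ≡⟨ sumFin-cong (λ i →
           indicator-⇔ ((y ≟F y) ×-dec (ℓ ≟F box i y)) (ℓ ≟F box i y) (mk⇔ proj₂ (refl ,_))) ⟩
    sumFin (λ i → indicator (ℓ ≟F box i y))
      ≡⟨ colIncidence y ℓ ⟩
    adj* (C , y) (B , ℓ) ∎
    where open ≡-Reasoning

  module _ (L : Grid) (sudoku : IsSudoku L) where

    private
      once : SymbolsCoveredOnce L
      once = Equivalence.to (isSudoku⇔ L) sudoku

      count≡1 : ∀ K x K' y → CoveredOnce L K x K' y → coverCount cliqueEdge L (K , x) (K' , y) ≡ 1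
      count≡1 K x K' y = Equivalence.from (cliqueCount≡1⇔ L K x K' y)

      flip : ∀ u v {c} → coverCount cliqueEdge L v u ≡ c → coverCount cliqueEdge L u v ≡ c
      flip u v = trans (cliqueCount-sym L u v)

    sudoku⇒cliqueCount : ∀ u v → u ≢ v → coverCount cliqueEdge L u v ≡ adj* u v
    sudoku⇒cliqueCount (R , x) (R , y) ne = cliqueCount-same-kind L R x y (ne ∘ cong (R ,_))
    sudoku⇒cliqueCount (R , x) (C , y) _ = count≡1 R x C y (rowColCoveredOnce L x y)
    sudoku⇒cliqueCount (R , x) (B , ℓ) _ = cliqueCount-row-box L x ℓ
    sudoku⇒cliqueCount (R , x) (Sy , k) _ = count≡1 R x Sy k (proj₁ (once x k))
    sudoku⇒cliqueCount (C , x) (R , y) _ = flip (C , x) (R , y) (count≡1 R y C x (rowColCoveredOnce L y x))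
    sudoku⇒cliqueCount (C , x) (C , y) ne = cliqueCount-same-kind L C x y (ne ∘ cong (C ,_))
    sudoku⇒cliqueCount (C , y) (B , ℓ) _ = cliqueCount-col-box L y ℓ
    sudoku⇒cliqueCount (C , x) (Sy , k) _ = count≡1 C x Sy k (proj₁ (proj₂ (once x k)))
    sudoku⇒cliqueCount (B , ℓ) (R , x) _ = flip (B , ℓ) (R , x) (cliqueCount-row-box L x ℓ)
    sudoku⇒cliqueCount (B , ℓ) (C , y) _ = flip (B , ℓ) (C , y) (cliqueCount-col-box L y ℓ)
    sudoku⇒cliqueCount (B , x) (B , y) ne = cliqueCount-same-kind L B x y (ne ∘ cong (B ,_))
    sudoku⇒cliqueCount (B , x) (Sy , k) _ = count≡1 B x Sy k (proj₂ (proj₂ (once x k)))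
    sudoku⇒cliqueCount (Sy , k) (R , x) _ = flip (Sy , k) (R , x) (count≡1 R x Sy k (proj₁ (once x k)))
    sudoku⇒cliqueCount (Sy , k) (C , x) _ = flip (Sy , k) (C , x) (count≡1 C x Sy k (proj₁ (proj₂ (once x k))))
    sudoku⇒cliqueCount (Sy , k) (B , x) _ = flip (Sy , k) (B , x) (count≡1 B x Sy k (proj₂ (proj₂ (once x k))))
    sudoku⇒cliqueCount (Sy , x) (Sy , y) ne = cliqueCount-same-kind L Sy x y (ne ∘ cong (Sy ,_))

    sudoku⇒tileCount : ∀ u v → u ≢ v → coverCount tileEdge L u v ≡ adj u v
    sudoku⇒tileCount u v ne = begin
      coverCount tileEdge L u v               ≡⟨ tileCount≡adj*cliqueCount L u v ⟩
      adj u v * coverCount cliqueEdge L u v   ≡⟨ cong (adj u v *_) (sudoku⇒cliqueCount u v ne) ⟩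
      adj u v * adj* u v                      ≡⟨ adj*adj*≡adj u v ⟩
      adj u v                                 ∎
      where open ≡-Reasoning

  tileCount⇒sudoku : ∀ L → (∀ u v → u ≢ v → coverCount tileEdge L u v ≡ adj u v) → IsSudoku L
  tileCount⇒sudoku L counts = Equivalence.from (isSudoku⇔ L) λ x k →
    symbolEdge R x k (λ ()) refl , symbolEdge C x k (λ ()) refl , symbolEdge B x k (λ ()) refl
    where
    symbolEdge : ∀ K x k → (K , x) ≢ (Sy , k) → adj (K , x) (Sy , k) ≡ 1 → CoveredOnce L K x Sy k
    symbolEdge K x k ne adj≡1 = Equivalence.to (cliqueCount≡1⇔ L K x Sy k)
      (trans (cliqueCount≡tileCount L (K , x) (Sy , k) adj≡1) (trans (counts (K , x) (Sy , k) ne) adj≡1))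

  filledTerm : (Cell → V → V → ℕ) → V → V → Maybe (Fin n) → Fin n → Fin n → ℕ
  filledTerm e u v nothing i j = 0
  filledTerm e u v (just k) i j = e (i , j , k) u v

  -- `filledSum` sums a function local to its where-block; unification names it here.
  private
    summand : ∀ S e u v → Σ (Fin n → Fin n → ℕ) λ F → filledSum S e u v ≡ ∑cells F
    summand S e u v = _ , refl

  filledSum≡∑cells : ∀ S e u v → filledSum S e u v ≡ ∑cells (λ i j → filledTerm e u v (S i j) i j)
  filledSum≡∑cells S e u v = trans (proj₂ (summand S e u v)) (∑cells-cong pointwise)
    where
    pointwise : ∀ i j → proj₁ (summand S e u v) i j ≡ filledTerm e u v (S i j) i j
    pointwise i j with S i j
    ... | nothing = refl
    ... | just k = refl

  filledSum-cong : ∀ S {e e'} u v u' v' → (∀ t → e t u v ≡ e' t u' v') →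
                   filledSum S e u v ≡ filledSum S e' u' v'
  filledSum-cong S {e} {e'} u v u' v' e≗e' = begin
    filledSum S e u v                                     ≡⟨ filledSum≡∑cells S e u v ⟩
    ∑cells (λ i j → filledTerm e u v (S i j) i j)         ≡⟨ ∑cells-cong (λ i j → pointwise (S i j) i j) ⟩
    ∑cells (λ i j → filledTerm e' u' v' (S i j) i j)      ≡⟨ filledSum≡∑cells S e' u' v' ⟨
    filledSum S e' u' v'                                  ∎
    where
    open ≡-Reasoning
    pointwise : ∀ s i j → filledTerm e u v s i j ≡ filledTerm e' u' v' s i j
    pointwise nothing i j = refl
    pointwise (just k) i j = e≗e' (i , j , k)

  filledTiles≡adj*filledCliques : ∀ S u v → filledSum S tileEdge u v ≡ adj u v * filledSum S cliqueEdge u v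
  filledTiles≡adj*filledCliques S u v = begin
    filledSum S tileEdge u v
      ≡⟨ filledSum≡∑cells S tileEdge u v ⟩
    ∑cells (λ i j → filledTerm tileEdge u v (S i j) i j)
      ≡⟨ ∑cells-cong (λ i j → pointwise (S i j) i j) ⟩
    ∑cells (λ i j → adj u v * filledTerm cliqueEdge u v (S i j) i j)
      ≡⟨ ∑cells-*ˡ (adj u v) _ ⟩
    adj u v * ∑cells (λ i j → filledTerm cliqueEdge u v (S i j) i j)
      ≡⟨ cong (adj u v *_) (filledSum≡∑cells S cliqueEdge u v) ⟨
    adj u v * filledSum S cliqueEdge u v ∎
    where
    open ≡-Reasoning
    pointwise : ∀ s i j → filledTerm tileEdge u v s i j ≡ adj u v * filledTerm cliqueEdge u v s i j
    pointwise nothing i j = sym (*-zeroʳ (adj u v))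
    pointwise (just k) i j = tileEdge≡adj*cliqueEdge (i , j , k) u v

  filledCliques≤1 : ∀ S K x K' y →
    (∀ i j k i' j' k' → S i j ≡ just k → S i' j' ≡ just k' →
       x ≡ coord K (i , j , k) × y ≡ coord K' (i , j , k) →
       x ≡ coord K (i' , j' , k') × y ≡ coord K' (i' , j' , k') → (i , j) ≡ (i' , j')) →
    filledSum S cliqueEdge (K , x) (K' , y) ≤ 1
  filledCliques≤1 S K x K' y unique =
    ≤-trans (≤-reflexive (filledSum≡∑cells S cliqueEdge (K , x) (K' , y)))
            (∑cells≤1 (λ i j → term≤1 (S i j) i j) λ i j i' j' nz nz' →
               let k , Sij≡k , covers = witness (S i j) i j nz
                   k' , Si'j'≡k' , covers' = witness (S i' j') i' j' nz'
               in unique i j k i' j' k' Sij≡k Si'j'≡k' covers covers')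
    where
    term≤1 : ∀ s i j → filledTerm cliqueEdge (K , x) (K' , y) s i j ≤ 1
    term≤1 nothing i j = z≤n
    term≤1 (just k) i j = ≤-trans (≤-reflexive (cliqueEdge-coord (i , j , k) K x K' y))
                                  (indicator≤1 ((x ≟F coord K (i , j , k)) ×-dec (y ≟F coord K' (i , j , k))))
    witness : ∀ s i j → filledTerm cliqueEdge (K , x) (K' , y) s i j ≢ 0 →
              Σ (Fin n) λ k → s ≡ just k × x ≡ coord K (i , j , k) × y ≡ coord K' (i , j , k)
    witness nothing i j 0≢0 = ⊥-elim (0≢0 refl)
    witness (just k) i j nz = k , refl ,
      indicator≢0⇒ ((x ≟F coord K (i , j , k)) ×-dec (y ≟F coord K' (i , j , k)))
                   (nz ∘ trans (cliqueEdge-coord (i , j , k) K x K' y))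

  module _ (S : Array) (partial : IsPartialSudoku S) where

    private
      rowCol : ∀ x y → filledSum S cliqueEdge (R , x) (C , y) ≤ 1
      rowCol x y = filledCliques≤1 S R x C y λ { _ _ _ _ _ _ _ _ (refl , refl) (refl , refl) → refl }

      rowSymbol : ∀ x k → filledSum S cliqueEdge (R , x) (Sy , k) ≤ 1
      rowSymbol x k = filledCliques≤1 S R x Sy k λ
        { i j _ _ j' _ Sij Sij' (refl , refl) (refl , refl) → cong (i ,_) (proj₁ partial i j j' k Sij Sij') }

      colSymbol : ∀ y k → filledSum S cliqueEdge (C , y) (Sy , k) ≤ 1
      colSymbol y k = filledCliques≤1 S C y Sy k λ
        { i j _ i' _ _ Sij Si'j (refl , refl) (refl , refl) → cong (_, j) (proj₁ (proj₂ partial) i i' j k Sij Si'j) }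

      boxSymbol : ∀ ℓ k → filledSum S cliqueEdge (B , ℓ) (Sy , k) ≤ 1
      boxSymbol ℓ k = filledCliques≤1 S B ℓ Sy k λ
        { i j _ i' j' _ Sij Si'j' (ℓ≡box , refl) (ℓ≡box' , refl) →
            proj₂ (proj₂ partial) i j i' j' k Sij Si'j' (trans (sym ℓ≡box) ℓ≡box') }

      flip : ∀ u v → filledSum S cliqueEdge v u ≤ 1 → filledSum S cliqueEdge u v ≤ 1
      flip u v = ≤-trans (≤-reflexive (filledSum-cong S u v v u (λ t → cliqueEdge-sym t u v)))

      bound : ∀ u v → adj u v * filledSum S cliqueEdge u v ≤ adj u v
      bound (R , _) (R , _) = z≤n
      bound (R , x) (C , y) = *-monoʳ-≤ 1 (rowCol x y)
      bound (R , _) (B , _) = z≤n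
      bound (R , x) (Sy , k) = *-monoʳ-≤ 1 (rowSymbol x k)
      bound (C , y) (R , x) = *-monoʳ-≤ 1 (flip (C , y) (R , x) (rowCol x y))
      bound (C , _) (C , _) = z≤n
      bound (C , _) (B , _) = z≤n
      bound (C , y) (Sy , k) = *-monoʳ-≤ 1 (colSymbol y k)
      bound (B , _) (R , _) = z≤n
      bound (B , _) (C , _) = z≤n
      bound (B , _) (B , _) = z≤n
      bound (B , ℓ) (Sy , k) = *-monoʳ-≤ 1 (boxSymbol ℓ k)
      bound (Sy , k) (R , x) = *-monoʳ-≤ 1 (flip (Sy , k) (R , x) (rowSymbol x k))
      bound (Sy , k) (C , y) = *-monoʳ-≤ 1 (flip (Sy , k) (C , y) (colSymbol y k))
      bound (Sy , k) (B , ℓ) = *-monoʳ-≤ 1 (flip (Sy , k) (B , ℓ) (boxSymbol ℓ k))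
      bound (Sy , _) (Sy , _) = z≤n

    filledTiles≤adj : ∀ u v → filledSum S tileEdge u v ≤ adj u v
    filledTiles≤adj u v = ≤-trans (≤-reflexive (filledTiles≡adj*filledCliques S u v)) (bound u v)

  -- A completion yields both decompositions

  Agrees : Array → Grid → Set
  Agrees S L = ∀ i j k → S i j ≡ just k → L i j ≡ k

  isEmpty : Maybe (Fin n) → ℕ
  isEmpty nothing = 1
  isEmpty (just _) = 0

  isEmpty≤1 : ∀ s → isEmpty s ≤ 1
  isEmpty≤1 nothing = ≤-refl
  isEmpty≤1 (just _) = z≤n

  sum-concat-tabulate : ∀ {m} {A : Set} (g : A → ℕ) (F : Fin m → List A) →
                        sum (map g (concat (tabulate F))) ≡ sumFin (λ x → sum (map g (F x)))
  sum-concat-tabulate {0} g F = refl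
  sum-concat-tabulate {suc m} g F = begin
    sum (map g (F fzero ++ concat (tabulate (F ∘ fsuc))))
      ≡⟨ cong sum (map-++ g (F fzero) _) ⟩
    sum (map g (F fzero) ++ map g (concat (tabulate (F ∘ fsuc))))
      ≡⟨ sum-++ (map g (F fzero)) _ ⟩
    sum (map g (F fzero)) + sum (map g (concat (tabulate (F ∘ fsuc))))
      ≡⟨ cong (sum (map g (F fzero)) +_) (sum-concat-tabulate g (F ∘ fsuc)) ⟩
    sum (map g (F fzero)) + sumFin (λ x → sum (map g (F (fsuc x)))) ∎
    where open ≡-Reasoning

  cellIfEmpty : Maybe (Fin n) → Cell → List Cell
  cellIfEmpty nothing t = t ∷ []
  cellIfEmpty (just _) t = []

  emptyCells : Array → Grid → List Cell
  emptyCells S L = concat (tabulate λ i → concat (tabulate λ j → cellIfEmpty (S i j) (i , j , L i j)))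

  sum-emptyCells : ∀ S L (g : Cell → ℕ) →
                   sum (map g (emptyCells S L)) ≡ ∑cells (λ i j → isEmpty (S i j) * g (i , j , L i j))
  sum-emptyCells S L g =
    trans (sum-concat-tabulate g cellsOfRow) (sumFin-cong λ i →
      trans (sum-concat-tabulate g (cellOfRow i)) (sumFin-cong λ j → cellTerm (S i j) (i , j , L i j)))
    where
    cellOfRow : Fin n → Fin n → List Cell
    cellOfRow i j = cellIfEmpty (S i j) (i , j , L i j)
    cellsOfRow : Fin n → List Cell
    cellsOfRow i = concat (tabulate (cellOfRow i))
    cellTerm : ∀ s t → sum (map g (cellIfEmpty s t)) ≡ isEmpty s * g t
    cellTerm nothing t = refl
    cellTerm (just _) t = refl

  coverCount-split : ∀ S L → Agrees S L → ∀ e u v →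
                     coverCount e L u v ≡ sum (map (λ t → e t u v) (emptyCells S L)) + filledSum S e u v
  coverCount-split S L agree e u v = begin
    coverCount e L u v
      ≡⟨ ∑cells-cong (λ i j → pointwise i j (S i j) (agree i j)) ⟩
    ∑cells (λ i j → isEmpty (S i j) * e (i , j , L i j) u v + filledTerm e u v (S i j) i j)
      ≡⟨ ∑cells-+ _ _ ⟩
    ∑cells (λ i j → isEmpty (S i j) * e (i , j , L i j) u v) + ∑cells (λ i j → filledTerm e u v (S i j) i j)
      ≡⟨ cong (∑cells (λ i j → isEmpty (S i j) * e (i , j , L i j) u v) +_) (filledSum≡∑cells S e u v) ⟨
    ∑cells (λ i j → isEmpty (S i j) * e (i , j , L i j) u v) + filledSum S e u v
      ≡⟨ cong (_+ filledSum S e u v) (sum-emptyCells S L (λ t → e t u v)) ⟨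
    sum (map (λ t → e t u v) (emptyCells S L)) + filledSum S e u v ∎
    where
    open ≡-Reasoning
    pointwise : ∀ i j s → (∀ k → s ≡ just k → L i j ≡ k) →
                e (i , j , L i j) u v ≡ isEmpty s * e (i , j , L i j) u v + filledTerm e u v s i j
    pointwise i j nothing _ = sym (trans (+-identityʳ _) (*-identityˡ _))
    pointwise i j (just k) agrees = cong (λ k → e (i , j , k) u v) (agrees k refl)

  edgesOfEmptyCells : ∀ S L → Agrees S L → ∀ e u v →
                      sum (map (λ t → e t u v) (emptyCells S L)) ≡ coverCount e L u v ∸ filledSum S e u v
  edgesOfEmptyCells S L agree e u v =
    m+n≡o⇒m≡o∸n _ (filledSum S e u v) (sym (coverCount-split S L agree e u v))

  completion⇒tileDecomposition : ∀ S → HasCompletion S → TileDecomposition S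
  completion⇒tileDecomposition S (L , sudoku , agree) = emptyCells S L , λ u v u≢v →
    trans (edgesOfEmptyCells S L agree tileEdge u v)
          (cong (_∸ filledSum S tileEdge u v) (sudoku⇒tileCount L sudoku u v u≢v))

  completion⇒K4Decomposition : ∀ S → HasCompletion S → K4Decomposition (G*_S S)
  completion⇒K4Decomposition S (L , sudoku , agree) = map toQuad (emptyCells S L) , distinct , counts
    where
    distinct : ∀ q → q ∈ map toQuad (emptyCells S L) → Distinct q
    distinct q q∈ with t , _ , refl ← ∈-map⁻ toQuad q∈ = toQuad-distinct t
    counts : ∀ u v → u ≢ v → sum (map (λ q → quadEdge q u v) (map toQuad (emptyCells S L))) ≡ G*_S S u v
    counts u v u≢v = begin
      sum (map (λ q → quadEdge q u v) (map toQuad (emptyCells S L)))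
        ≡⟨ cong sum (trans (sym (map-∘ (emptyCells S L)))
                           (map-cong (λ t → quadEdge-toQuad t u v) (emptyCells S L))) ⟩
      sum (map (λ t → cliqueEdge t u v) (emptyCells S L))
        ≡⟨ edgesOfEmptyCells S L agree cliqueEdge u v ⟩
      coverCount cliqueEdge L u v ∸ filledSum S cliqueEdge u v
        ≡⟨ cong (_∸ filledSum S cliqueEdge u v) (sudoku⇒cliqueCount L sudoku u v u≢v) ⟩
      G*_S S u v ∎
      where open ≡-Reasoning

  -- A tile decomposition yields a completion

  tilesAt : List Cell → Fin n → Fin n → ℕ
  tilesAt T i j = sum (map (λ t → tileEdge t (R , i) (C , j)) T)

  symbolAt : List Cell → Fin n → Fin n → Fin n
  symbolAt [] i j = i  -- junk: only read on cells that carry exactly one tile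
  symbolAt ((a , b , c) ∷ T) i j = if does ((i ≟F a) ×-dec (j ≟F b)) then c else symbolAt T i j

  tileEdge-row-col : ∀ t i j → tileEdge t (R , i) (C , j) ≡ indicator ((i ≟F coord R t) ×-dec (j ≟F coord C t))
  tileEdge-row-col (a , b , c) i j = cliqueEdge-coord (a , b , c) R i C j

  sum≡∑cells-tilesAt : ∀ T → (∀ i j → tilesAt T i j ≤ 1) → ∀ (g : Cell → ℕ) →
                       sum (map g T) ≡ ∑cells (λ i j → tilesAt T i j * g (i , j , symbolAt T i j))
  sum≡∑cells-tilesAt [] _ g = sym (∑cells-zero λ _ _ → refl)
  sum≡∑cells-tilesAt ((a , b , c) ∷ T) atMostOne g = begin
    g (a , b , c) + sum (map g T)
      ≡⟨ cong₂ _+_ (sym headTile) (sum≡∑cells-tilesAt T (λ i j → m+n≤o⇒n≤o _ (atMostOne i j)) g) ⟩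
    ∑cells (λ i j → indicator (at i j) * g (a , b , c))
      + ∑cells (λ i j → tilesAt T i j * g (i , j , symbolAt T i j))
      ≡⟨ ∑cells-+ _ _ ⟨
    ∑cells (λ i j → indicator (at i j) * g (a , b , c) + tilesAt T i j * g (i , j , symbolAt T i j))
      ≡⟨ ∑cells-cong (λ i j → pointwise i j (at i j)) ⟨
    ∑cells (λ i j → (indicator (at i j) + tilesAt T i j) * g (i , j , symbolAt ((a , b , c) ∷ T) i j))
      ≡⟨ ∑cells-cong (λ i j → cong (λ m → (m + tilesAt T i j) * g (i , j , symbolAt ((a , b , c) ∷ T) i j))
                                    (tileEdge-row-col (a , b , c) i j)) ⟨
    ∑cells (λ i j → tilesAt ((a , b , c) ∷ T) i j * g (i , j , symbolAt ((a , b , c) ∷ T) i j)) ∎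
    where
    open ≡-Reasoning
    at : ∀ i j → Dec (i ≡ a × j ≡ b)
    at i j = (i ≟F a) ×-dec (j ≟F b)
    headTile : ∑cells (λ i j → indicator (at i j) * g (a , b , c)) ≡ g (a , b , c)
    headTile = begin
      ∑cells (λ i j → indicator (at i j) * g (a , b , c))
        ≡⟨ ∑cells-single a b (λ i j ne →
             cong (_* g (a , b , c)) (indicator-no (at i j) λ { (refl , refl) → ne refl })) ⟩
      indicator (at a b) * g (a , b , c)
        ≡⟨ cong (_* g (a , b , c)) (indicator-yes (at a b) (refl , refl)) ⟩
      1 * g (a , b , c)
        ≡⟨ *-identityˡ _ ⟩
      g (a , b , c) ∎
    noOtherAt : tilesAt T a b ≡ 0
    noOtherAt = n≤0⇒n≡0 (≤-pred (≤-trans (≤-reflexive (cong (_+ tilesAt T a b)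
      (sym (trans (tileEdge-row-col (a , b , c) a b) (indicator-yes (at a b) (refl , refl)))))) (atMostOne a b)))
    pointwise : ∀ i j (d : Dec (i ≡ a × j ≡ b)) →
                (indicator d + tilesAt T i j) * g (i , j , (if does d then c else symbolAt T i j))
                  ≡ indicator d * g (a , b , c) + tilesAt T i j * g (i , j , symbolAt T i j)
    pointwise i j (yes (refl , refl)) rewrite noOtherAt = sym (+-identityʳ _)
    pointwise i j (no _) = refl

  module _ (S : Array) (partial : IsPartialSudoku S) (T : List Cell)
           (decomposes : ∀ u v → u ≢ v → sum (map (λ t → tileEdge t u v) T) ≡ G_S S u v) where

    private
      filledRowCol : ∀ i j → filledSum S tileEdge (R , i) (C , j) ≡ filledTerm tileEdge (R , i) (C , j) (S i j) i j
      filledRowCol i j =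
        trans (filledSum≡∑cells S tileEdge (R , i) (C , j))
              (∑cells-single i j λ i' j' ne → other i' j' ne (S i' j'))
        where
        other : ∀ i' j' → (i' , j') ≢ (i , j) → ∀ s → filledTerm tileEdge (R , i) (C , j) s i' j' ≡ 0
        other i' j' ne nothing = refl
        other i' j' ne (just k) = trans (tileEdge-row-col (i' , j' , k) i j)
          (indicator-no ((i ≟F i') ×-dec (j ≟F j'))
                        λ (i≡i' , j≡j') → ne (cong₂ _,_ (sym i≡i') (sym j≡j')))

    tilesAt≡isEmpty : ∀ i j → tilesAt T i j ≡ isEmpty (S i j)
    tilesAt≡isEmpty i j = begin
      tilesAt T i j                                         ≡⟨ decomposes (R , i) (C , j) (λ ()) ⟩
      1 ∸ filledSum S tileEdge (R , i) (C , j)              ≡⟨ cong (1 ∸_) (filledRowCol i j) ⟩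
      1 ∸ filledTerm tileEdge (R , i) (C , j) (S i j) i j   ≡⟨ emptiness (S i j) ⟩
      isEmpty (S i j)                                       ∎
      where
      open ≡-Reasoning
      emptiness : ∀ s → 1 ∸ filledTerm tileEdge (R , i) (C , j) s i j ≡ isEmpty s
      emptiness nothing = refl
      emptiness (just k) = cong (1 ∸_)
        (trans (tileEdge-row-col (i , j , k) i j) (indicator-yes ((i ≟F i) ×-dec (j ≟F j)) (refl , refl)))

    completionGrid : Grid
    completionGrid i j = fromMaybe (symbolAt T i j) (S i j)

    completionGrid-agrees : Agrees S completionGrid
    completionGrid-agrees i j k Sij≡k rewrite Sij≡k = refl

    tiles≡emptyCells : ∀ (g : Cell → ℕ) → sum (map g T) ≡ sum (map g (emptyCells S completionGrid))
    tiles≡emptyCells g = begin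
      sum (map g T)
        ≡⟨ sum≡∑cells-tilesAt T atMostOne g ⟩
      ∑cells (λ i j → tilesAt T i j * g (i , j , symbolAt T i j))
        ≡⟨ ∑cells-cong (λ i j → trans (cong (_* g (i , j , symbolAt T i j)) (tilesAt≡isEmpty i j))
                                      (filledOrNot i j (S i j))) ⟩
      ∑cells (λ i j → isEmpty (S i j) * g (i , j , completionGrid i j))
        ≡⟨ sum-emptyCells S completionGrid g ⟨
      sum (map g (emptyCells S completionGrid)) ∎
      where
      open ≡-Reasoning
      atMostOne : ∀ i j → tilesAt T i j ≤ 1
      atMostOne i j = ≤-trans (≤-reflexive (tilesAt≡isEmpty i j)) (isEmpty≤1 (S i j))
      filledOrNot : ∀ i j s → isEmpty s * g (i , j , symbolAt T i j)
                              ≡ isEmpty s * g (i , j , fromMaybe (symbolAt T i j) s)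
      filledOrNot i j nothing = refl
      filledOrNot i j (just _) = refl

    completionGrid-tileCount : ∀ u v → u ≢ v → coverCount tileEdge completionGrid u v ≡ adj u v
    completionGrid-tileCount u v u≢v = begin
      coverCount tileEdge completionGrid u v
        ≡⟨ coverCount-split S completionGrid completionGrid-agrees tileEdge u v ⟩
      sum (map (λ t → tileEdge t u v) (emptyCells S completionGrid)) + filledSum S tileEdge u v
        ≡⟨ cong (_+ filledSum S tileEdge u v) (tiles≡emptyCells (λ t → tileEdge t u v)) ⟨
      sum (map (λ t → tileEdge t u v) T) + filledSum S tileEdge u v
        ≡⟨ cong (_+ filledSum S tileEdge u v) (decomposes u v u≢v) ⟩
      adj u v ∸ filledSum S tileEdge u v + filledSum S tileEdge u v
        ≡⟨ m∸n+n≡m (filledTiles≤adj S partial u v) ⟩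
      adj u v ∎
      where open ≡-Reasoning

    tileDecomposition⇒completion : HasCompletion S
    tileDecomposition⇒completion =
      completionGrid , tileCount⇒sudoku completionGrid completionGrid-tileCount , completionGrid-agrees

  -- A K4-decomposition yields a tile decomposition

  injective⇒allKinds : (f : Fin 4 → Kind) → (∀ p p' → f p ≡ f p' → p ≡ p') →
                       ∀ K → ∃ λ p → f p ≡ K
  injective⇒allKinds f injective K with any? (λ p → f p ≟K K)
  ... | yes hit = hit
  -- otherwise f would inject Fin 4 into the three kinds other than K
  ... | no missed =
    let avoid : ∀ p → kindIndex K ≢ kindIndex (f p)
        avoid p eq = missed (p , sym (kindIndex-injective eq))
        p , p' , p<p' , collide = pigeonhole (n<1+n 3) (λ p → punchOut (avoid p))
    in ⊥-elim (<⇒≢ᶠ p<p' (injective p p' (kindIndex-injective (punchOut-injective (avoid p) (avoid p') collide))))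

  module CliqueOfQuad (q : Quad) (adjacent : ∀ p p' → p ≢ p' → adj* (lookup q p) (lookup q p') ≢ 0) where

    kindOf : Fin 4 → Kind
    kindOf p = proj₁ (lookup q p)

    kindOf-injective : ∀ p p' → kindOf p ≡ kindOf p' → p ≡ p'
    kindOf-injective p p' same with p ≟F p'
    ... | yes p≡p' = p≡p'
    ... | no p≢p' = ⊥-elim (adjacent p p' p≢p'
      (subst (λ K → adj* (kindOf p , proj₂ (lookup q p)) (K , proj₂ (lookup q p')) ≡ 0) same
             (adj*-same-kind (kindOf p) _ _)))

    position : Kind → Fin 4
    position K = proj₁ (injective⇒allKinds kindOf kindOf-injective K)

    kindOf-position : ∀ K → kindOf (position K) ≡ K
    kindOf-position K = proj₂ (injective⇒allKinds kindOf kindOf-injective K)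

    coordOf : Kind → Fin n
    coordOf K = proj₂ (lookup q (position K))

    lookup-position : ∀ K → lookup q (position K) ≡ (K , coordOf K)
    lookup-position K = cong (_, coordOf K) (kindOf-position K)

    incident : ∀ K K' → K ≢ K' → adj* (K , coordOf K) (K' , coordOf K') ≢ 0
    incident K K' K≢K' = subst₂ (λ u v → adj* u v ≢ 0) (lookup-position K) (lookup-position K')
      (adjacent (position K) (position K') λ same →
        K≢K' (trans (sym (kindOf-position K)) (trans (cong kindOf same) (kindOf-position K'))))

    cell : Cell
    cell = coordOf R , coordOf C , coordOf Sy

    coord-cell : ∀ K → coord K cell ≡ coordOf K
    coord-cell R = refl
    coord-cell C = refl
    coord-cell B = box-incident (coordOf R) (coordOf C) (coordOf B)
      (if≢0⇒ (rowInc (coordOf R) (coordOf B)) (incident R B λ ()))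
      (if≢0⇒ (colInc (coordOf C) (coordOf B)) (incident C B λ ()))
    coord-cell Sy = refl

    ∈-quad⇔ : ∀ K x → (K , x) ∈ toList q ⇔ x ≡ coordOf K
    ∈-quad⇔ K x = mk⇔ to from
      where
      to : (K , x) ∈ toList q → x ≡ coordOf K
      to member = cong proj₂ (begin
        (K , x)                        ≡⟨ lookup-index m ⟩
        lookup q (index m)             ≡⟨ cong (lookup q) (kindOf-injective (index m) (position K)
                                            (trans (cong proj₁ (sym (lookup-index m))) (sym (kindOf-position K)))) ⟩
        lookup q (position K)          ≡⟨ lookup-position K ⟩
        (K , coordOf K)                ∎)
        where
        open ≡-Reasoning
        m : (K , x) Vec.∈ q
        m = ∈-toList⁻ member
      from : x ≡ coordOf K → (K , x) ∈ toList q
      from refl = ∈-toList⁺ (subst (λ u → u Vec.∈ q) (lookup-position K) (∈-lookup (position K) q))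

    ∈?-quad : ∀ K x → (K , x) ∈? toList q ≡ (K , x) ∈? cellVerts (coordOf R) (coordOf C) (coordOf Sy)
    ∈?-quad K x = begin
      (K , x) ∈? toList q                   ≡⟨ ∈?≡does (K , x) (toList q) ⟩
      does ((K , x) ∈ᵈ? toList q)           ≡⟨ does-⇔ (∈-quad⇔ K x) ((K , x) ∈ᵈ? toList q) (x ≟F coordOf K) ⟩
      does (x ≟F coordOf K)                 ≡⟨ cong (does ∘ (x ≟F_)) (coord-cell K) ⟨
      does (x ≟F coord K cell)              ≡⟨ ∈?-cellVerts K x (coordOf R) (coordOf C) (coordOf Sy) ⟨
      (K , x) ∈? cellVerts (coordOf R) (coordOf C) (coordOf Sy) ∎
      where open ≡-Reasoning

    quadEdge≡cliqueEdge : ∀ u v → quadEdge q u v ≡ cliqueEdge cell u v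
    quadEdge≡cliqueEdge (K , x) (K' , y) = cong₂ (λ a b → if a ∧ b then 1 else 0) (∈?-quad K x) (∈?-quad K' y)

  quadsToTiles : ∀ (Q : List Quad) →
                 (∀ {q} → q ∈ Q → Σ Cell λ t → ∀ u v → quadEdge q u v ≡ cliqueEdge t u v) →
                 Σ (List Cell) λ T → ∀ u v →
                   sum (map (λ t → tileEdge t u v) T) ≡ adj u v * sum (map (λ q → quadEdge q u v) Q)
  quadsToTiles [] _ = [] , λ u v → sym (*-zeroʳ (adj u v))
  quadsToTiles (q ∷ Q) cellOf with t , q≗t ← cellOf (here refl) | T , sums ← quadsToTiles Q (cellOf ∘ there) =
    t ∷ T , λ u v → begin
      tileEdge t u v + sum (map (λ t → tileEdge t u v) T)
        ≡⟨ cong₂ _+_ (trans (tileEdge≡adj*cliqueEdge t u v) (cong (adj u v *_) (sym (q≗t u v)))) (sums u v) ⟩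
      adj u v * quadEdge q u v + adj u v * sum (map (λ q → quadEdge q u v) Q)
        ≡⟨ *-distribˡ-+ (adj u v) (quadEdge q u v) _ ⟨
      adj u v * sum (map (λ q → quadEdge q u v) (q ∷ Q)) ∎
    where open ≡-Reasoning

  adj*G*_S≡G_S : ∀ S u v → adj u v * G*_S S u v ≡ G_S S u v
  adj*G*_S≡G_S S u v = begin
    adj u v * (adj* u v ∸ filledSum S cliqueEdge u v)
      ≡⟨ *-distribˡ-∸ (adj u v) (adj* u v) _ ⟩
    adj u v * adj* u v ∸ adj u v * filledSum S cliqueEdge u v
      ≡⟨ cong₂ _∸_ (adj*adj*≡adj u v) (sym (filledTiles≡adj*filledCliques S u v)) ⟩
    adj u v ∸ filledSum S tileEdge u v ∎
    where open ≡-Reasoning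

  K4Decomposition⇒tileDecomposition : ∀ S → K4Decomposition (G*_S S) → TileDecomposition S
  K4Decomposition⇒tileDecomposition S (Q , distinct , counts) =
    proj₁ tiles , λ u v u≢v →
      trans (proj₂ tiles u v) (trans (cong (adj u v *_) (counts u v u≢v)) (adj*G*_S≡G_S S u v))
    where
    adjacent : ∀ {q} → q ∈ Q → ∀ p p' → p ≢ p' → adj* (lookup q p) (lookup q p') ≢ 0
    adjacent {q} q∈Q p p' p≢p' adj*≡0 = <⇒≢ (begin
      1
        ≡⟨ cong₂ (λ a b → if a ∧ b then 1 else 0) (∈?-true (member p)) (∈?-true (member p')) ⟨
      quadEdge q u v
        ≤⟨ ∈⇒≤sum-map (λ q' → quadEdge q' u v) q∈Q ⟩
      sum (map (λ q' → quadEdge q' u v) Q)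
        ≡⟨ counts u v (distinct q q∈Q p p' p≢p') ⟩
      G*_S S u v
        ≤⟨ m∸n≤m (adj* u v) (filledSum S cliqueEdge u v) ⟩
      adj* u v ∎) (sym adj*≡0)
      where
      open ≤-Reasoning
      u v : V
      u = lookup q p
      v = lookup q p'
      member : ∀ p → lookup q p ∈ toList q
      member p = ∈-toList⁺ (∈-lookup p q)
    cellOf : ∀ {q} → q ∈ Q → Σ Cell λ t → ∀ u v → quadEdge q u v ≡ cliqueEdge t u v
    cellOf {q} q∈Q = CliqueOfQuad.cell q (adjacent q∈Q) , CliqueOfQuad.quadEdge≡cliqueEdge q (adjacent q∈Q)
    tiles = quadsToTiles Q cellOf


proposition2p1 : (h w : ℕ) (2≤h : 2 ≤ h) (2≤w : 2 ≤ w) (S : Sudoku.Array h w 2≤h 2≤w) →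
    Sudoku.IsPartialSudoku h w 2≤h 2≤w S →
    (Sudoku.HasCompletion h w 2≤h 2≤w S ⇔ Sudoku.TileDecomposition h w 2≤h 2≤w S)
    × (Sudoku.TileDecomposition h w 2≤h 2≤w S ⇔ Sudoku.K4Decomposition h w 2≤h 2≤w (Sudoku.G*_S h w 2≤h 2≤w S))
proposition2p1 h w 2≤h 2≤w S partial =
    mk⇔ (completion⇒tileDecomposition S) tiles⇒completion
  , mk⇔ (completion⇒K4Decomposition S ∘ tiles⇒completion) (K4Decomposition⇒tileDecomposition S)
  where
  open Decompositions h w 2≤h 2≤w
  tiles⇒completion : Sudoku.TileDecomposition h w 2≤h 2≤w S → Sudoku.HasCompletion h w 2≤h 2≤w S
  tiles⇒completion (T , decomposes) = tileDecomposition⇒completion S partial T decomposes
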